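{- Let $G$ be a median graph with basepoint $v_0$, and let $u,v\in V$ with $u\in I(v_0,v)$. Then the ladder set $L_{u,v}$ is a pairwise orthogonal family. Moreover, there exists a shortest $(u,v)$-path whose first $|L_{u,v}|$ edges belong to the classes of $L_{u,v}$.
   Context: $G=(V,E)$ is a finite, simple, connected, undirected median graph: for all vertices $x,y,z$ the set $I(x,y)\cap I(y,z)\cap I(z,x)$ has exactly one element, where $I(u,v)=\{w: d(u,w)+d(w,v)=d(u,v)\}$. Edges $uv,xy$ are in relation $\Theta_0$ if $uvyx$ is a 4-cycle; $\Theta$ is the reflexive transitive closure of $\Theta_0$, with equivalence classes $E_1,\dots,E_q$ ($\Theta$-classes). For each $i$, $(V,E\setminus E_i)$ has exactly two connected components (halfspaces). Classes $E_i,E_j$ are orthogonal if there is a 4-cycle $uvyx$ with $uv,xy\in E_i$ and $ux,vy\in E_j$; a pairwise orthogonal family (POF) is a set of classes any two distinct members of which are orthogonal. The signature $\sigma_{u,v}$ is the set of classes $E_i$ such that $u,v$ lie in different halfspaces of $E_i$. For $u\in I(v_0,v)$, the ladder set $L_{u,v}$ is the set of classes in $\sigma_{u,v}$ having an edge incident to $u$. -}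

module Defs where

open import Data.Nat using (ℕ; zero; suc; _+_; _≤_; _<_)
open import Data.Fin using (Fin)
open import Data.Bool using (Bool; true; false; T)
open import Data.Product using (Σ; Σ-syntax; ∃; ∃-syntax; _×_; _,_)
open import Data.Sum using (_⊎_)
open import Relation.Nullary using (¬_)
open import Relation.Binary.PropositionalEquality using (_≡_; _≢_)
open import Relation.Binary.Construct.Closure.ReflexiveTransitive using (Star)

record Graph : Set where
  field
    n   : ℕ
    adj : Fin n → Fin n → Bool

module _ (G : Graph) where
  open Graph G

  V : Set
  V = Fin n

  Adj : V → V → Set
  Adj u v = T (adj u v)

  data Walk : V → V → ℕ → Set where
    here : ∀ {u} → Walk u u 0
    step : ∀ {u w v k} → Adj u w → Walk w v k → Walk u v (suc k)

  IsDist : V → V → ℕ → Set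
  IsDist u v k = Walk u v k × (∀ m → Walk u v m → k ≤ m)

  InI : V → V → V → Set
  InI u v w = ∃[ a ] ∃[ b ] ∃[ c ]
    (IsDist u w a × IsDist w v b × IsDist u v c × a + b ≡ c)

  record IsMedianGraph : Set where
    field
      sym       : ∀ u v → adj u v ≡ adj v u
      irrefl    : ∀ u → adj u u ≡ false
      connected : ∀ u v → ∃[ k ] Walk u v k
      median    : ∀ x y z → ∃[ m ] ((InI x y m × InI y z m × InI z x m) ×
                    (∀ m' → InI x y m' × InI y z m' × InI z x m' → m' ≡ m))

  record Edge : Set where
    constructor edge
    field
      src : V
      tgt : V
      isAdj : Adj src tgt

  FourCycle : V → V → V → V → Set
  FourCycle u v y x = Adj u v × Adj v y × Adj y x × Adj x u × u ≢ y × v ≢ x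

  Θ₀ : Edge → Edge → Set
  Θ₀ e f = FourCycle (Edge.src e) (Edge.tgt e) (Edge.tgt f) (Edge.src f)

  -- edges are unordered: an oriented edge is identified with its reverse
  Flip : Edge → Edge → Set
  Flip e f = (Edge.src f ≡ Edge.tgt e) × (Edge.tgt f ≡ Edge.src e)

  ΘStep : Edge → Edge → Set
  ΘStep e f = Θ₀ e f ⊎ Flip e f

  Θ : Edge → Edge → Set
  Θ = Star ΘStep

  data WalkAvoid (e : Edge) : V → V → Set where
    here : ∀ {u} → WalkAvoid e u u
    step : ∀ {u w v} (a : Adj u w) → ¬ Θ (edge u w a) e → WalkAvoid e w v → WalkAvoid e u v

  -- the class of e lies in σ_{u,v}: u and v in different halfspaces of that class
  InSig : V → V → Edge → Set
  InSig u v e = ¬ WalkAvoid e u v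

  InL : V → V → Edge → Set
  InL u v e = InSig u v e × ∃[ w ] Σ[ a ∈ Adj u w ] Θ (edge u w a) e

  Orthogonal : Edge → Edge → Set
  Orthogonal e f = ∃[ u ] ∃[ v ] ∃[ y ] ∃[ x ] Σ[ c ∈ FourCycle u v y x ]
    (let (uv , vy , yx , xu , _ , _) = c in
      Θ (edge u v uv) e × Θ (edge y x yx) e × Θ (edge x u xu) f × Θ (edge v y vy) f)

  IsPOF : (Edge → Set) → Set
  IsPOF P = ∀ e f → P e → P f → ¬ Θ e f → Orthogonal e f

  record ShortestPath (u v : V) : Set where
    field
      len    : ℕ
      dist   : IsDist u v len
      vert   : ℕ → V
      start  : vert 0 ≡ u
      end    : vert len ≡ v
      adjs   : ∀ i → i < len → Adj (vert i) (vert (suc i))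

    edgeAt : ∀ i → i < len → Edge
    edgeAt i lt = edge (vert i) (vert (suc i)) (adjs i lt)

  -- the first k edges of p belong to the classes of L_{u,v}, and k = |L_{u,v}|:
  -- i ↦ class of the i-th edge is a bijection from {0..k-1} onto L_{u,v}.
  FirstEdgesInL : ∀ {u v} → ShortestPath u v → Set
  FirstEdgesInL {u} {v} p =
    Σ[ k ∈ ℕ ] Σ[ k≤ ∈ k ≤ len ]
      ((∀ i (i<k : i < k) → InL u v (edgeAt i (lt i i<k k≤))) ×
       (∀ i j (i<k : i < k) (j<k : j < k) → i ≢ j →
          ¬ Θ (edgeAt i (lt i i<k k≤)) (edgeAt j (lt j j<k k≤))) ×
       (∀ e → InL u v e → ∃[ i ] Σ[ i<k ∈ i < k ] Θ (edgeAt i (lt i i<k k≤)) e))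
    where
      open ShortestPath p
      open import Data.Nat.Properties using (<-≤-trans)
      lt : ∀ i {k} → i < k → k ≤ len → i < len
      lt i i<k k≤ = <-≤-trans i<k k≤

-- For an edge ab let W a b be the set of vertices closer to a than to b. In a median graph every
-- vertex lies in exactly one of W a b and W b a, and an edge is Θ-related to ab exactly when it
-- joins W a b to W b a (Djoković–Winkler). Hence if the class of an edge uw lies in σ u v, then w
-- is one step closer to v than u. Two such neighbours w, w' of u span a square u w m w'
-- (quadrangle condition), so their classes are orthogonal. The same square completion carries
-- every remaining such neighbour along each step from u towards v, so a geodesic from u to v can
-- cross the classes of all of them first, one after another.

module Submission where

open import Defs
open import Data.Product using (Σ-syntax; _×_)
open import Data.Product using (_,_; proj₁; proj₂)
open import Data.Sum using (_⊎_; inj₁; inj₂)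
open import Data.Nat using (ℕ; zero; suc; _+_; _≤_; _<_; z≤n; s≤s)
open import Data.Nat.Properties
import Data.Fin.Properties as Fin
open import Data.Bool using (T)
open import Data.Bool.Properties using (T-irrelevant)
open import Data.Unit using (⊤; tt)
open import Data.Empty using (⊥; ⊥-elim)
open import Data.List using (List; []; _∷_; length; filter; allFin)
open import Data.List.Relation.Unary.All as All using (All; []; _∷_)
open import Data.List.Relation.Unary.All.Properties using (all-filter)
open import Data.List.Relation.Unary.Any using (here; there)
open import Data.List.Relation.Unary.Unique.Propositional using (Unique; _∷_)
open import Data.List.Relation.Unary.Unique.Propositional.Properties using (filter⁺; allFin⁺)
open import Data.List.Membership.Propositional using (_∈_)
open import Data.List.Membership.Propositional.Properties using (∈-filter⁺; ∈-allFin)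
open import Function using (_∘_)
open import Relation.Nullary using (¬_; Dec; yes; no)
open import Relation.Nullary.Decidable using (T?; _×-dec_; map′)
open import Relation.Unary using (Decidable)
open import Relation.Binary.PropositionalEquality
open import Relation.Binary.Construct.Closure.ReflexiveTransitive using (ε; _◅_; _◅◅_; reverse)

2+n≢n : ∀ {n} → suc (suc n) ≢ n
2+n≢n {suc n} = 2+n≢n ∘ suc-injective

m+n≡1⇒m≡0∨n≡0 : ∀ m n → m + n ≡ 1 → m ≡ 0 ⊎ n ≡ 0
m+n≡1⇒m≡0∨n≡0 zero          _       _  = inj₁ refl
m+n≡1⇒m≡0∨n≡0 (suc _)       zero    _  = inj₂ refl
m+n≡1⇒m≡0∨n≡0 (suc zero)    (suc _) ()
m+n≡1⇒m≡0∨n≡0 (suc (suc _)) (suc _) ()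

m+n≡2⇒m≡0∨n≡0∨m≡n≡1 : ∀ m n → m + n ≡ 2 → m ≡ 0 ⊎ n ≡ 0 ⊎ (m ≡ 1 × n ≡ 1)
m+n≡2⇒m≡0∨n≡0∨m≡n≡1 zero                _             _  = inj₁ refl
m+n≡2⇒m≡0∨n≡0∨m≡n≡1 (suc _)             zero          _  = inj₂ (inj₁ refl)
m+n≡2⇒m≡0∨n≡0∨m≡n≡1 (suc zero)          (suc zero)    _  = inj₂ (inj₂ (refl , refl))
m+n≡2⇒m≡0∨n≡0∨m≡n≡1 (suc zero)          (suc (suc _)) ()
m+n≡2⇒m≡0∨n≡0∨m≡n≡1 (suc (suc zero))    (suc _)       ()
m+n≡2⇒m≡0∨n≡0∨m≡n≡1 (suc (suc (suc _))) (suc _)       ()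

+-squeeze : ∀ {a b i l} → a ≤ i → b ≤ l → i + l ≤ a + b → a ≡ i × b ≡ l
+-squeeze {a} {b} {i} {l} a≤i b≤l i+l≤a+b =
  a≡i , ≤-antisym b≤l (+-cancelˡ-≤ i l b (subst (λ z → i + l ≤ z + b) a≡i i+l≤a+b))
  where
  a≡i : a ≡ i
  a≡i = ≤-antisym a≤i (≮⇒≥ λ a<i → <⇒≱ (+-mono-<-≤ a<i b≤l) i+l≤a+b)

module _ (G : Graph) (M : IsMedianGraph G) where
  open IsMedianGraph M using (connected; median)

  infix 4 _~_
  _~_ : V G → V G → Set
  _~_ = Adj G

  ~-sym : ∀ {x y} → x ~ y → y ~ x
  ~-sym {x} {y} = subst T (IsMedianGraph.sym M x y)

  ~-irrefl : ∀ {x} → ¬ x ~ x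
  ~-irrefl {x} = subst T (IsMedianGraph.irrefl M x)

  -- Distances

  walk? : ∀ k x y → Dec (Walk G x y k)
  walk? zero x y with x Fin.≟ y
  ... | yes refl = yes here
  ... | no x≢y = no λ { here → x≢y refl }
  walk? (suc k) x y =
    map′ (λ (z , xz , w) → step xz w) (λ { (step xz w) → _ , xz , w })
      (Fin.any? λ z → T? (Graph.adj G x z) ×-dec walk? k z y)

  least-walk-below : ∀ x y b → (∀ j → j < b → ¬ Walk G x y j) ⊎ Σ[ k ∈ ℕ ] IsDist G x y k
  least-walk-below x y zero = inj₁ λ _ ()
  least-walk-below x y (suc b) with least-walk-below x y b
  ... | inj₂ found = inj₂ found
  ... | inj₁ none-below with walk? b x y
  ...   | yes w = inj₂ (b , w , λ j wj → ≮⇒≥ λ j<b → none-below j j<b wj)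
  ...   | no ¬w = inj₁ none-up-to-b
    where
    none-up-to-b : ∀ j → j < suc b → ¬ Walk G x y j
    none-up-to-b j j<1+b with m≤n⇒m<n∨m≡n (≤-pred j<1+b)
    ... | inj₁ j<b = none-below j j<b
    ... | inj₂ refl = ¬w

  shortest-walk : ∀ x y → Σ[ k ∈ ℕ ] IsDist G x y k
  shortest-walk x y with connected x y
  ... | k , w with least-walk-below x y (suc k)
  ...   | inj₁ none = ⊥-elim (none k (n<1+n k) w)
  ...   | inj₂ found = found

  dist : V G → V G → ℕ
  dist x y = proj₁ (shortest-walk x y)

  dist-isDist : ∀ x y → IsDist G x y (dist x y)
  dist-isDist x y = proj₂ (shortest-walk x y)

  geodesic : ∀ x y → Walk G x y (dist x y)
  geodesic x y = proj₁ (dist-isDist x y)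

  dist-minimal : ∀ {x y k} → Walk G x y k → dist x y ≤ k
  dist-minimal {x} {y} = proj₂ (dist-isDist x y) _

  isDist⇒≡dist : ∀ {x y k} → IsDist G x y k → k ≡ dist x y
  isDist⇒≡dist {x} {y} (w , minimal) = ≤-antisym (minimal _ (geodesic x y)) (dist-minimal w)

  walk-snoc : ∀ {x y z k} → Walk G x y k → y ~ z → Walk G x z (suc k)
  walk-snoc here yz = step yz here
  walk-snoc (step xw w) yz = step xw (walk-snoc w yz)

  walk-reverse : ∀ {x y k} → Walk G x y k → Walk G y x k
  walk-reverse here = here
  walk-reverse (step xw w) = walk-snoc (walk-reverse w) (~-sym xw)

  walk-append : ∀ {x y z k l} → Walk G x y k → Walk G y z l → Walk G x z (k + l)
  walk-append here w = w
  walk-append (step xw w) w′ = step xw (walk-append w w′)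

  dist-refl : ∀ x → dist x x ≡ 0
  dist-refl x = n≤0⇒n≡0 (dist-minimal {x} here)

  dist≡0⇒≡ : ∀ {x y} → dist x y ≡ 0 → x ≡ y
  dist≡0⇒≡ {x} {y} eq with subst (Walk G x y) eq (geodesic x y)
  ... | here = refl

  dist-sym : ∀ x y → dist x y ≡ dist y x
  dist-sym x y = ≤-antisym (dist-minimal (walk-reverse (geodesic y x))) (dist-minimal (walk-reverse (geodesic x y)))

  dist-triangle : ∀ x y z → dist x z ≤ dist x y + dist y z
  dist-triangle x y z = dist-minimal (walk-append (geodesic x y) (geodesic y z))

  dist-~ : ∀ {x y} → x ~ y → dist x y ≡ 1
  dist-~ {x} {y} xy with dist x y in eq | dist-minimal (step xy here)
  ... | zero        | _ = ⊥-elim (~-irrefl (subst (x ~_) (sym (dist≡0⇒≡ eq)) xy))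
  ... | suc zero    | _ = refl
  ... | suc (suc _) | s≤s ()

  dist≡1⇒~ : ∀ {x y} → dist x y ≡ 1 → x ~ y
  dist≡1⇒~ {x} {y} eq with subst (Walk G x y) eq (geodesic x y)
  ... | step xy here = xy

  dist-stepʳ : ∀ x {y z} → y ~ z → dist x z ≤ suc (dist x y)
  dist-stepʳ x {y} yz = dist-minimal (walk-snoc (geodesic x y) yz)

  dist-stepˡ : ∀ {a b} → a ~ b → ∀ x → dist b x ≤ suc (dist a x)
  dist-stepˡ {a} {b} ab x = subst (dist b x ≤_) (cong (_+ dist a x) (dist-~ (~-sym ab))) (dist-triangle b a x)

  geodesic-step : ∀ {x y t} → dist x y ≡ suc t → Σ[ x' ∈ V G ] x ~ x' × dist x' y ≡ t
  geodesic-step {x} {y} {t} eq with subst (Walk G x y) eq (geodesic x y)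
  ... | step {w = x'} xx' rest = x' , xx' , ≤-antisym (dist-minimal rest) t≤
    where
    t≤ : t ≤ dist x' y
    t≤ = ≤-pred (subst (_≤ suc (dist x' y)) eq (dist-minimal (step xx' (geodesic x' y))))

  -- Intervals and medians

  InI⇒dist : ∀ {x y z} → InI G x y z → dist x z + dist z y ≡ dist x y
  InI⇒dist (_ , _ , _ , xz , zy , xy , sum) =
    trans (cong₂ _+_ (sym (isDist⇒≡dist xz)) (sym (isDist⇒≡dist zy))) (trans sum (isDist⇒≡dist xy))

  dist⇒InI : ∀ {x y z} → dist x z + dist z y ≡ dist x y → InI G x y z
  dist⇒InI {x} {y} {z} sum = _ , _ , _ , dist-isDist x z , dist-isDist z y , dist-isDist x y , sum

  InI-sym : ∀ {x y z} → InI G x y z → InI G y x z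
  InI-sym {x} {y} {z} xzy = dist⇒InI (begin
    dist y z + dist z x ≡⟨ cong₂ _+_ (dist-sym y z) (dist-sym z x) ⟩
    dist z y + dist x z ≡⟨ +-comm (dist z y) _ ⟩
    dist x z + dist z y ≡⟨ InI⇒dist xzy ⟩
    dist x y            ≡⟨ dist-sym x y ⟩
    dist y x            ∎)
    where open ≡-Reasoning

  IsMedian : V G → V G → V G → V G → Set
  IsMedian x y z m = InI G x y m × InI G y z m × InI G z x m

  median-unique : ∀ {x y z m m'} → IsMedian x y z m → IsMedian x y z m' → m ≡ m'
  median-unique {x} {y} {z} {m} {m'} med med' with median x y z
  ... | _ , _ , unique = trans (unique m med) (sym (unique m' med'))

  -- Halfspaces

  W : V G → V G → V G → Set
  W a b x = dist b x ≡ suc (dist a x)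

  W⇒distˡ : ∀ {a b x} → W a b x → dist x b ≡ suc (dist x a)
  W⇒distˡ {a} {b} {x} = subst₂ (λ m n → m ≡ suc n) (dist-sym b x) (dist-sym a x)

  distˡ⇒W : ∀ {a b x} → dist x b ≡ suc (dist x a) → W a b x
  distˡ⇒W {a} {b} {x} = subst₂ (λ m n → m ≡ suc n) (dist-sym x b) (dist-sym x a)

  W-self : ∀ {a b} → a ~ b → W a b a
  W-self {a} ab = trans (dist-~ (~-sym ab)) (cong suc (sym (dist-refl a)))

  W-disjoint : ∀ {a b x} → W a b x → W b a x → ⊥
  W-disjoint Wab Wba = 2+n≢n (sym (trans Wab (cong suc Wba)))

  -- The median of a, b and x lies on the edge ab.
  W-dichotomy : ∀ {a b} → a ~ b → ∀ x → W a b x ⊎ W b a x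
  W-dichotomy {a} {b} ab x with median a b x
  ... | m , (abm , bxm , xam) , _ with m+n≡1⇒m≡0∨n≡0 (dist a m) (dist m b) (trans (InI⇒dist abm) (dist-~ ab))
  ... | inj₁ am≡0 with dist≡0⇒≡ am≡0
  ...   | refl = inj₁ (trans (sym (InI⇒dist bxm)) (cong (_+ dist a x) (dist-~ (~-sym ab))))
  W-dichotomy {a} {b} ab x | m , (abm , bxm , xam) , _ | inj₂ mb≡0 with dist≡0⇒≡ mb≡0
  ...   | refl = inj₂ (trans (sym (InI⇒dist (InI-sym xam))) (cong (_+ dist b x) (dist-~ ab)))

  W-crossing-dist : ∀ {a b p r} → W a b p → W b a r → p ~ r → dist a p ≡ dist b r
  W-crossing-dist {a} {b} {p} {r} Wp Wr pr = ≤-antisym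
    (≤-pred (subst (_≤ suc (dist b r)) Wp (dist-stepʳ b (~-sym pr))))
    (≤-pred (subst (_≤ suc (dist a p)) Wr (dist-stepʳ a pr)))

  W-towards : ∀ {a b x x'} → a ~ b → W a b x → x' ~ x → W x' x a → W a b x'
  W-towards {a} {b} {x} {x'} ab Wx x'x Wx' = ≤-antisym (dist-stepˡ ab x') (≤-pred (subst (_≤ suc (dist b x')) bx≡ (dist-stepʳ b x'x)))
    where
    bx≡ : dist b x ≡ suc (suc (dist a x'))
    bx≡ = trans Wx (cong suc (W⇒distˡ Wx'))

  W-interval : ∀ {a b x y} → a ~ b → W a b y → dist a x + dist x y ≡ dist a y → W a b x
  W-interval {a} {b} {x} {y} ab Wy axy = ≤-antisym (dist-stepˡ ab x) (+-cancelʳ-≤ (dist x y) _ _ lower)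
    where
    lower : suc (dist a x) + dist x y ≤ dist b x + dist x y
    lower = subst (_≤ dist b x + dist x y) (trans Wy (cong suc (sym axy))) (dist-triangle b x y)

  -- The quadrangle condition

  dist-two : ∀ {x y z} → x ≢ y → x ~ z → z ~ y → dist x y ≡ 2
  dist-two {x} {y} {z} x≢y xz zy with W-dichotomy zy x
  ... | inj₁ Wzy = trans (dist-sym x y) (trans Wzy (cong suc (dist-~ (~-sym xz))))
  ... | inj₂ Wyz = ⊥-elim (x≢y (sym (dist≡0⇒≡ (suc-injective (trans (sym Wyz) (dist-~ (~-sym xz)))))))

  not-between : ∀ {v c x y} → x ≢ y → c ~ x → c ~ y → W x c v → W y c v → ¬ InI G y v x
  not-between {v} {c} {x} {y} x≢y cx cy Wx Wy yxv = 2+n≢n (begin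
    2 + dist x v        ≡⟨ cong (_+ dist x v) (dist-two (x≢y ∘ sym) (~-sym cy) cx) ⟨
    dist y x + dist x v ≡⟨ InI⇒dist yxv ⟩
    dist y v            ≡⟨ suc-injective (trans (sym Wy) Wx) ⟩
    dist x v            ∎)
    where open ≡-Reasoning

  square-completion : ∀ {v c x y} → x ≢ y → c ~ x → c ~ y → W x c v → W y c v →
    Σ[ m ∈ V G ] x ~ m × y ~ m × c ≢ m × W m x v
  square-completion {v} {c} {x} {y} x≢y cx cy Wx Wy with median x y v
  ... | m , (xym , yvm , vxm) , _
      with m+n≡2⇒m≡0∨n≡0∨m≡n≡1 (dist x m) (dist m y) (trans (InI⇒dist xym) (dist-two x≢y (~-sym cx) cy))
  ... | inj₁ xm≡0 with dist≡0⇒≡ xm≡0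
  ...   | refl = ⊥-elim (not-between x≢y cx cy Wx Wy yvm)
  square-completion {v} {c} {x} {y} x≢y cx cy Wx Wy | m , (xym , yvm , vxm) , _ | inj₂ (inj₁ my≡0) with dist≡0⇒≡ my≡0
  ...   | refl = ⊥-elim (not-between (x≢y ∘ sym) cy cx Wy Wx (InI-sym vxm))
  square-completion {v} {c} {x} {y} x≢y cx cy Wx Wy | m , (xym , yvm , vxm) , _ | inj₂ (inj₂ (xm≡1 , my≡1)) =
    m , dist≡1⇒~ xm≡1 , dist≡1⇒~ (trans (dist-sym y m) my≡1) , c≢m , Wm
    where
    Wm : W m x v
    Wm = trans (sym (InI⇒dist (InI-sym vxm))) (cong (_+ dist m v) xm≡1)
    c≢m : c ≢ m
    c≢m refl = W-disjoint Wx Wm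

  common-neighbour-isMedian : ∀ {p q z b} → p ≢ q → p ~ z → z ~ q →
    dist b p ≡ suc (dist b z) → dist b q ≡ suc (dist b z) → IsMedian p q b z
  common-neighbour-isMedian {p} {q} {z} {b} p≢q pz zq bp bq =
    dist⇒InI (trans (cong₂ _+_ (dist-~ pz) (dist-~ zq)) (sym (dist-two p≢q pz zq))) ,
    dist⇒InI (trans (cong₂ _+_ (dist-~ (~-sym zq)) (dist-sym z b)) (trans (sym bq) (dist-sym b q))) ,
    dist⇒InI (trans (cong (dist b z +_) (dist-~ (~-sym pz))) (trans (+-comm (dist b z) 1) (sym bp)))

  -- Otherwise r and the square completion of p r q would both be medians of p, q and b.
  common-neighbour∉W : ∀ {a b p q r} → a ~ b → p ≢ q → p ~ r → r ~ q → W a b p → W a b q → ¬ W b a r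
  common-neighbour∉W {a} {b} {p} {q} {r} ab p≢q pr rq Wp Wq Wr =
    no-second-median (square-completion p≢q (~-sym pr) rq (distˡ⇒W (trans Wr (cong suc (sym ap≡br))))
                                                           (distˡ⇒W (trans Wr (cong suc (sym aq≡br)))))
    where
    ap≡br : dist a p ≡ dist b r
    ap≡br = W-crossing-dist Wp Wr pr
    aq≡br : dist a q ≡ dist b r
    aq≡br = W-crossing-dist Wq Wr (~-sym rq)
    no-second-median : Σ[ m ∈ V G ] p ~ m × q ~ m × r ≢ m × W m p a → ⊥
    no-second-median (m , pm , qm , r≢m , Wm) = r≢m (median-unique r-median m-median)
      where
      bm≡br : dist b m ≡ dist b r
      bm≡br = trans (W-towards ab Wp (~-sym pm) Wm) (trans (sym (W⇒distˡ Wm)) ap≡br)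
      r-median : IsMedian p q b r
      r-median = common-neighbour-isMedian p≢q pr rq (trans Wp (cong suc ap≡br)) (trans Wq (cong suc aq≡br))
      m-median : IsMedian p q b m
      m-median = common-neighbour-isMedian p≢q pm (~-sym qm)
        (trans Wp (cong suc (trans ap≡br (sym bm≡br)))) (trans Wq (cong suc (trans aq≡br (sym bm≡br))))

  W-square : ∀ {a b x y x' y'} → a ~ b → W a b x → W b a y → FourCycle G x y y' x' → W a b x' × W b a y'
  W-square {a} {b} {x} {y} {x'} {y'} ab Wx Wy (xy , yy' , y'x' , x'x , x≢y' , y≢x') = Wx' , Wy'
    where
    Wx' : W a b x'
    Wx' with W-dichotomy ab x'
    ... | inj₁ W' = W'
    ... | inj₂ W' = ⊥-elim (common-neighbour∉W (~-sym ab) y≢x' (~-sym xy) (~-sym x'x) Wy W' Wx)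
    Wy' : W b a y'
    Wy' with W-dichotomy ab y'
    ... | inj₁ W' = ⊥-elim (common-neighbour∉W ab x≢y' xy yy' Wx W' Wy)
    ... | inj₂ W' = W'

  -- The Djoković–Winkler description of Θ

  Θ-sym : ∀ {e f} → Θ G e f → Θ G f e
  Θ-sym = reverse {T = ΘStep G} (λ {e} {f} → ΘStep-sym {e} {f})
    where
    ΘStep-sym : ∀ {e f} → ΘStep G e f → ΘStep G f e
    ΘStep-sym (inj₁ (uv , vy , yx , xu , u≢y , v≢x)) =
      inj₁ (~-sym yx , ~-sym vy , ~-sym uv , ~-sym xu , v≢x ∘ sym , u≢y ∘ sym)
    ΘStep-sym (inj₂ (refl , refl)) = inj₂ (refl , refl)

  Splits : Edge G → Edge G → Set
  Splits (edge a b _) (edge x y _) = (W a b x × W b a y) ⊎ (W b a x × W a b y)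

  Splits-step : ∀ e {f g} → Splits e f → ΘStep G f g → Splits e g
  Splits-step (edge a b ab) (inj₁ (Wx , Wy)) (inj₁ square) = inj₁ (W-square ab Wx Wy square)
  Splits-step (edge a b ab) (inj₂ (Wx , Wy)) (inj₁ square) = inj₂ (W-square (~-sym ab) Wx Wy square)
  Splits-step (edge a b ab) (inj₁ (Wx , Wy)) (inj₂ (refl , refl)) = inj₂ (Wy , Wx)
  Splits-step (edge a b ab) (inj₂ (Wx , Wy)) (inj₂ (refl , refl)) = inj₁ (Wy , Wx)

  Θ⇒Splits : ∀ {e f} → Θ G e f → Splits e f
  Θ⇒Splits {e@(edge a b ab)} = splits-along (inj₁ (W-self ab , W-self (~-sym ab)))
    where
    splits-along : ∀ {f g} → Splits e f → Θ G f g → Splits e g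
    splits-along s ε = s
    splits-along {f} s (_◅_ {j = h} st sts) = splits-along (Splits-step e {f} {h} s st) sts

  -- Induction on the distance from x to a: a square x y m x' moves the edge xy one step towards ab.
  W-crossing⇒Θ : ∀ t {a b x y} (ab : a ~ b) (xy : x ~ y) → dist x a ≡ t → W a b x → W b a y →
    Θ G (edge x y xy) (edge a b ab)
  W-crossing⇒Θ zero ab xy xa≡0 Wx Wy with dist≡0⇒≡ xa≡0
  ... | refl with dist≡0⇒≡ (suc-injective (trans (sym Wy) (dist-~ xy)))
  ...   | refl with T-irrelevant ab xy
  ...     | refl = ε
  W-crossing⇒Θ (suc t) {a} {b} {x} {y} ab xy xa≡ Wx Wy with geodesic-step xa≡
  ... | x' , xx' , x'a≡t = descend (square-completion y≢x' xy xx' Wy-closer Wx'-closer)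
    where
    x'-closer : W x' x a
    x'-closer = trans xa≡ (cong suc (sym x'a≡t))
    Wx' : W a b x'
    Wx' = W-towards ab Wx (~-sym xx') x'-closer
    y≢x' : y ≢ x'
    y≢x' refl = W-disjoint Wx' Wy
    Wy-closer : W y x b
    Wy-closer = distˡ⇒W (trans Wx (cong suc (W-crossing-dist Wx Wy xy)))
    Wx'-closer : W x' x b
    Wx'-closer = distˡ⇒W (trans Wx (cong suc (trans (W⇒distˡ x'-closer) (sym Wx'))))
    descend : Σ[ m ∈ V G ] y ~ m × x' ~ m × x ≢ m × W m y b → Θ G (edge x y xy) (edge a b ab)
    descend (m , ym , x'm , x≢m , Wm) =
      inj₁ (xy , ym , ~-sym x'm , ~-sym xx' , x≢m , y≢x')
      ◅ W-crossing⇒Θ t ab x'm x'a≡t Wx' (W-towards (~-sym ab) Wy (~-sym ym) Wm)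

  Splits⇒Θ : ∀ {e f} → Splits e f → Θ G f e
  Splits⇒Θ {edge a b ab} {edge x y xy} (inj₁ (Wx , Wy)) = W-crossing⇒Θ _ ab xy refl Wx Wy
  Splits⇒Θ {edge a b ab} {edge x y xy} (inj₂ (Wx , Wy)) = inj₂ (refl , refl) ◅ W-crossing⇒Θ _ ab (~-sym xy) refl Wy Wx

  Θ-same-side : ∀ {a b x y} (ab : a ~ b) (xy : x ~ y) → W a b x → W a b y → ¬ Θ G (edge x y xy) (edge a b ab)
  Θ-same-side ab xy Wx Wy t with Θ⇒Splits (Θ-sym t)
  ... | inj₁ (_ , Wy') = W-disjoint Wy Wy'
  ... | inj₂ (Wx' , _) = W-disjoint Wx Wx'

  Θ-distinct-neighbours : ∀ {u w w'} (uw : u ~ w) (uw' : u ~ w') → w ≢ w' → ¬ Θ G (edge u w uw) (edge u w' uw')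
  Θ-distinct-neighbours uw uw' w≢w' t with Θ⇒Splits t
  ... | inj₁ (_ , Ww') = w≢w' (dist≡0⇒≡ (suc-injective (trans (sym Ww') (dist-~ uw'))))
  ... | inj₂ (Wu , _) = W-disjoint (W-self uw) Wu

  -- Walks along geodesics

  walk-vertex : ∀ {x y k} → Walk G x y k → ℕ → V G
  walk-vertex {x} _ zero = x
  walk-vertex {x} here (suc i) = x
  walk-vertex (step _ w) (suc i) = walk-vertex w i

  walk-adj : ∀ {x y k} (w : Walk G x y k) i → i < k → walk-vertex w i ~ walk-vertex w (suc i)
  walk-adj (step xz _) zero _ = xz
  walk-adj (step _ w) (suc i) (s≤s i<k) = walk-adj w i i<k

  walk-vertex-end : ∀ {x y k} (w : Walk G x y k) → walk-vertex w k ≡ y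
  walk-vertex-end here = refl
  walk-vertex-end (step _ w) = walk-vertex-end w

  walk-edge : ∀ {x y k} (w : Walk G x y k) i → i < k → Edge G
  walk-edge w i i<k = edge (walk-vertex w i) (walk-vertex w (suc i)) (walk-adj w i i<k)

  walk-split : ∀ {x y k} (w : Walk G x y k) i → i ≤ k →
    Σ[ l ∈ ℕ ] Walk G x (walk-vertex w i) i × Walk G (walk-vertex w i) y l × i + l ≡ k
  walk-split {k = k} w zero _ = k , here , w , refl
  walk-split (step xz w) (suc i) (s≤s i≤k) with walk-split w i i≤k
  ... | l , pre , post , i+l≡k = l , step xz pre , post , cong suc i+l≡k

  geodesic-vertex-dist : ∀ {x y k} (w : Walk G x y k) → k ≡ dist x y → ∀ i → i ≤ k →
    dist x (walk-vertex w i) ≡ i × i + dist (walk-vertex w i) y ≡ k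
  geodesic-vertex-dist {x} {y} w k≡ i i≤k with walk-split w i i≤k
  ... | l , pre , post , i+l≡k
      with +-squeeze (dist-minimal pre) (dist-minimal post)
             (subst (_≤ dist x (walk-vertex w i) + dist (walk-vertex w i) y) (sym (trans i+l≡k k≡))
               (dist-triangle x (walk-vertex w i) y))
  ...   | xp≡i , py≡l = xp≡i , trans (cong (i +_) py≡l) i+l≡k

  walk-avoiding : ∀ {e x y k} (w : Walk G x y k) → (∀ i i<k → ¬ Θ G (walk-edge w i i<k) e) → WalkAvoid G e x y
  walk-avoiding here _ = here
  walk-avoiding (step xz w) not-Θ = step xz (not-Θ 0 (s≤s z≤n)) (walk-avoiding w λ i i<k → not-Θ (suc i) (s≤s i<k))

  WalkAvoid-preserves-W : ∀ {a b} (ab : a ~ b) {x y} → WalkAvoid G (edge a b ab) x y → W a b x → W a b y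
  WalkAvoid-preserves-W ab here Wx = Wx
  WalkAvoid-preserves-W ab (step {w = z} xz ¬Θ rest) Wx with W-dichotomy ab z
  ... | inj₁ Wz = WalkAvoid-preserves-W ab rest Wz
  ... | inj₂ Wz = ⊥-elim (¬Θ (Splits⇒Θ (inj₁ (Wx , Wz))))

  W-separated⇒InSig : ∀ {a b x y} (ab : a ~ b) → W a b x → W b a y → InSig G x y (edge a b ab)
  W-separated⇒InSig ab Wx Wy avoid = W-disjoint (WalkAvoid-preserves-W ab avoid Wx) Wy

  geodesic-edge∈σ : ∀ {x y k} (w : Walk G x y k) → k ≡ dist x y → ∀ i (i<k : i < k) → InSig G x y (walk-edge w i i<k)
  geodesic-edge∈σ {x} {y} w k≡ i i<k
      with geodesic-vertex-dist w k≡ i (<⇒≤ i<k) | geodesic-vertex-dist w k≡ (suc i) i<k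
  ... | xp≡i , ipy≡k | xq≡1+i , 1+iqy≡k = W-separated⇒InSig (walk-adj w i i<k) Wx Wy
    where
    Wx : W (walk-vertex w i) (walk-vertex w (suc i)) x
    Wx = distˡ⇒W (trans xq≡1+i (cong suc (sym xp≡i)))
    Wy : W (walk-vertex w (suc i)) (walk-vertex w i) y
    Wy = +-cancelˡ-≡ i _ _ (trans ipy≡k (trans (sym 1+iqy≡k) (sym (+-suc i _))))

  σ-neighbour-closer : ∀ {u v w e} (uw : u ~ w) → InSig G u v e → Θ G (edge u w uw) e → W w u v
  σ-neighbour-closer {u} {v} {w} {e} uw u|v uw-e with W-dichotomy uw v
  ... | inj₂ Wv = Wv
  ... | inj₁ Wv = ⊥-elim (u|v (walk-avoiding (geodesic u v) not-Θ))
    where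
    on-u-side : ∀ i → i ≤ dist u v → W u w (walk-vertex (geodesic u v) i)
    on-u-side i i≤ with geodesic-vertex-dist (geodesic u v) refl i i≤
    ... | up≡i , ipv≡d = W-interval uw Wv (trans (cong (_+ dist (walk-vertex (geodesic u v) i) v) up≡i) ipv≡d)
    not-Θ : ∀ i i<k → ¬ Θ G (walk-edge (geodesic u v) i i<k) e
    not-Θ i i<k t = Θ-same-side uw (walk-adj _ i i<k) (on-u-side i (<⇒≤ i<k)) (on-u-side (suc i) i<k) (t ◅◅ Θ-sym uw-e)

  -- The ladder set

  neighbours-orthogonal : ∀ {u v w w'} (uw : u ~ w) (uw' : u ~ w') → w ≢ w' → W w u v → W w' u v →
    Orthogonal G (edge u w uw) (edge u w' uw')
  neighbours-orthogonal {u} {v} {w} {w'} uw uw' w≢w' Ww Ww' with square-completion w≢w' uw uw' Ww Ww'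
  ... | m , wm , w'm , u≢m , _ =
    u , w , m , w' , square , ε ,
    Θ-sym (_◅_ {j = edge w' m w'm} (inj₁ square) (inj₂ (refl , refl) ◅ ε)) ,
    inj₂ (refl , refl) ◅ ε ,
    Θ-sym (inj₁ square' ◅ ε)
    where
    square : FourCycle G u w m w'
    square = uw , wm , ~-sym w'm , ~-sym uw' , u≢m , w≢w'
    square' : FourCycle G u w' m w
    square' = uw' , w'm , ~-sym wm , ~-sym uw , u≢m , w≢w' ∘ sym

  Orthogonal-resp-Θ : ∀ {e e' f f'} → Θ G e e' → Θ G f f' → Orthogonal G e f → Orthogonal G e' f'
  Orthogonal-resp-Θ ee' ff' (u , v , y , x , square , uv-e , yx-e , xu-f , vy-f) =
    u , v , y , x , square , uv-e ◅◅ ee' , yx-e ◅◅ ee' , xu-f ◅◅ ff' , vy-f ◅◅ ff'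

  module Ladder (u v : V G) where

    Descent : V G → V G → Set
    Descent c w = Σ[ x ∈ V G ] Σ[ cx ∈ c ~ x ] (W x c v × Σ[ uw ∈ u ~ w ] Θ G (edge c x cx) (edge u w uw))

    descent-transfer : ∀ {c x w w'} (cx : c ~ x) → W x c v → (uw : u ~ w) → Θ G (edge c x cx) (edge u w uw) →
      w ≢ w' → Descent c w' → Descent x w'
    descent-transfer {c} {x} cx Wx uw cx-uw w≢w' (x' , cx' , Wx' , uw' , cx'-uw') =
      across (square-completion x≢x' cx cx' Wx Wx')
      where
      x≢x' : x ≢ x'
      x≢x' refl with T-irrelevant cx cx'
      ... | refl = Θ-distinct-neighbours uw uw' w≢w' (Θ-sym cx-uw ◅◅ cx'-uw')
      across : Σ[ m ∈ V G ] x ~ m × x' ~ m × c ≢ m × W m x v → Descent x _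
      across (m , xm , x'm , c≢m , Wm) =
        m , xm , Wm , uw' , Θ-sym (inj₁ (cx' , x'm , ~-sym xm , ~-sym cx , c≢m , x≢x' ∘ sym) ◅ ε) ◅◅ cx'-uw'

    Through : ∀ {c k} → Walk G c v k → List (V G) → Set
    Through _ [] = ⊤
    Through here (_ ∷ _) = ⊥
    Through (step {u = c} {w = x} cx rest) (w ∷ ws) = (Σ[ uw ∈ u ~ w ] Θ G (edge c x cx) (edge u w uw)) × Through rest ws

    record LadderWalk (c : V G) (ws : List (V G)) : Set where
      field
        steps     : ℕ
        steps≡    : steps ≡ dist c v
        walk      : Walk G c v steps
        through   : Through walk ws

    ladder-walk : ∀ c ws → Unique ws → All (Descent c) ws → LadderWalk c ws
    ladder-walk c [] _ _ = record { steps = dist c v ; steps≡ = refl ; walk = geodesic c v ; through = tt }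
    ladder-walk c (w ∷ ws) (w∉ws ∷ unique) ((x , cx , Wx , uw , cx-uw) ∷ descents) = record
      { steps = suc steps ; steps≡ = trans (cong suc steps≡) (sym Wx) ; walk = step cx walk ; through = (uw , cx-uw) , through }
      where
      transferred : All (Descent x) ws
      transferred = All.zipWith (λ (w≢w' , descent) → descent-transfer cx Wx uw cx-uw w≢w' descent) (w∉ws , descents)
      open LadderWalk (ladder-walk x ws unique transferred)

    through-length : ∀ {c k} (w : Walk G c v k) ws → Through w ws → length ws ≤ k
    through-length _ [] _ = z≤n
    through-length (step _ w) (_ ∷ ws) (_ , th) = s≤s (through-length w ws th)

    through-edge : ∀ {c k} (w : Walk G c v k) ws → Through w ws → ∀ i → i < length ws → (i<k : i < k) →
      Σ[ w' ∈ V G ] w' ∈ ws × Σ[ uw' ∈ u ~ w' ] Θ G (walk-edge w i i<k) (edge u w' uw')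
    through-edge (step _ _) (w' ∷ _) ((uw' , t) , _) zero _ _ = w' , here refl , uw' , t
    through-edge (step _ w) (_ ∷ ws) (_ , th) (suc i) (s≤s i<) (s≤s i<k) with through-edge w ws th i i< i<k
    ... | w' , w'∈ws , uw' , t = w' , there w'∈ws , uw' , t

    through-head-distinct : ∀ {c k} (w : Walk G c v k) ws → Unique ws → Through w ws → ∀ j → suc j < length ws →
      (0<k : 0 < k) (1+j<k : suc j < k) → ¬ Θ G (walk-edge w 0 0<k) (walk-edge w (suc j) 1+j<k)
    through-head-distinct (step _ w) (w₀ ∷ ws) (w₀∉ws ∷ _) ((uw₀ , t₀) , th) j (s≤s j<) _ (s≤s j<k) t
      with through-edge w ws th j j< j<k
    ... | w' , w'∈ws , uw' , t' = Θ-distinct-neighbours uw₀ uw' (All.lookup w₀∉ws w'∈ws) (Θ-sym t₀ ◅◅ t ◅◅ t')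

    through-distinct : ∀ {c k} (w : Walk G c v k) ws → Unique ws → Through w ws → ∀ i j → i < length ws → j < length ws →
      i ≢ j → (i<k : i < k) (j<k : j < k) → ¬ Θ G (walk-edge w i i<k) (walk-edge w j j<k)
    through-distinct _ _ _ _ zero zero _ _ i≢j _ _ _ = i≢j refl
    through-distinct w ws unique th zero (suc j) _ j< _ i<k j<k =
      through-head-distinct w ws unique th j j< i<k j<k
    through-distinct w ws unique th (suc i) zero i< _ _ i<k j<k =
      through-head-distinct w ws unique th i i< j<k i<k ∘ Θ-sym
    through-distinct (step _ w) (_ ∷ ws) (_ ∷ unique) (_ , th) (suc i) (suc j) (s≤s i<) (s≤s j<) i≢j (s≤s i<k) (s≤s j<k) =
      through-distinct w ws unique th i j i< j< (i≢j ∘ cong suc) i<k j<k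

    through-covers : ∀ {c k} (w : Walk G c v k) ws → Through w ws → ∀ {w'} → w' ∈ ws → (uw' : u ~ w') →
      Σ[ i ∈ ℕ ] i < length ws × ((i<k : i < k) → Θ G (walk-edge w i i<k) (edge u w' uw'))
    through-covers (step _ _) (_ ∷ _) ((uw , t) , _) (here refl) uw' with T-irrelevant uw uw'
    ... | refl = zero , s≤s z≤n , λ _ → t
    through-covers (step _ w) (_ ∷ ws) (_ , th) (there w'∈ws) uw' with through-covers w ws th w'∈ws uw'
    ... | i , i< , t = suc i , s≤s i< , λ { (s≤s i<k) → t i<k }

    CloserNeighbour : V G → Set
    CloserNeighbour w = u ~ w × W w u v

    closer-neighbour? : Decidable CloserNeighbour
    closer-neighbour? w = T? (Graph.adj G u w) ×-dec (dist u v ≟ suc (dist w v))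

    closer-neighbours : List (V G)
    closer-neighbours = filter closer-neighbour? (allFin (Graph.n G))

    closer-neighbours-unique : Unique closer-neighbours
    closer-neighbours-unique = filter⁺ closer-neighbour? (allFin⁺ (Graph.n G))

    closer-neighbours-descents : All (Descent u) closer-neighbours
    closer-neighbours-descents =
      All.map (λ { {w} (uw , Ww) → w , uw , Ww , uw , ε }) (all-filter closer-neighbour? (allFin (Graph.n G)))

    open LadderWalk (ladder-walk u closer-neighbours closer-neighbours-unique closer-neighbours-descents)

    ladder-POF : IsPOF G (InL G u v)
    ladder-POF e f (u|v , w , uw , uw-e) (u|v' , w' , uw' , uw'-f) ¬e-f =
      Orthogonal-resp-Θ uw-e uw'-f
        (neighbours-orthogonal uw uw' w≢w' (σ-neighbour-closer uw u|v uw-e) (σ-neighbour-closer uw' u|v' uw'-f))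
      where
      w≢w' : w ≢ w'
      w≢w' refl with T-irrelevant uw uw'
      ... | refl = ¬e-f (Θ-sym uw-e ◅◅ uw'-f)

    ladder-path : ShortestPath G u v
    ladder-path = record
      { len = steps ; dist = subst (IsDist G u v) (sym steps≡) (dist-isDist u v)
      ; vert = walk-vertex walk ; start = refl ; end = walk-vertex-end walk ; adjs = walk-adj walk }

    ladder-first-edges : FirstEdgesInL G ladder-path
    ladder-first-edges =
      length closer-neighbours , through-length walk _ through ,
      (λ i i< → edge∈L i i< _) ,
      (λ i j i< j< i≢j → through-distinct walk _ closer-neighbours-unique through i j i< j< i≢j _ _) ,
      λ e e∈L → let i , i< , t = covers e e∈L in i , i< , t _
      where
      edge∈L : ∀ i → i < length closer-neighbours → (i<k : i < steps) → InL G u v (walk-edge walk i i<k)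
      edge∈L i i< i<k with through-edge walk _ through i i< i<k
      ... | w , _ , uw , t = geodesic-edge∈σ walk steps≡ i i<k , w , uw , Θ-sym t
      covers : ∀ e → InL G u v e → Σ[ i ∈ ℕ ] i < length closer-neighbours × ((i<k : i < steps) → Θ G (walk-edge walk i i<k) e)
      covers e (u|v , w , uw , uw-e)
        with through-covers walk _ through (∈-filter⁺ closer-neighbour? (∈-allFin w) (uw , σ-neighbour-closer uw u|v uw-e)) uw
      ... | i , i< , t = i , i< , λ i<k → t i<k ◅◅ uw-e

theorem4 : (G : Graph) → IsMedianGraph G → (v₀ u v : V G) → InI G v₀ v u →
    IsPOF G (InL G u v) × Σ[ p ∈ ShortestPath G u v ] FirstEdgesInL G p
theorem4 G M v₀ u v _ = ladder-POF , ladder-path , ladder-first-edges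
  where open Ladder G M u v
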